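{- Let $\mathbb{K}=(G,M,I)$ be a finite formal context and let $g\in G$, $m\in M$ with $(g,m)\notin I$. Then the subcontext $\mathbb{K}_{ -g-m}$ is rich if and only if $|\mathfrak{B}(G,M,J)|\geq|\mathfrak{B}(\mathbb{K})|$, where $J=I\cup\{(g,n):n\in M\setminus\{m\}\}\cup\{(h,m):h\in G\setminus\{g\}\}$.
   Context: $\mathfrak{B}(\cdot)$ denotes the set of formal concepts of a formal context. $\mathbb{K}_{ -g-m}:=(G\setminus\{g\},M\setminus\{m\},I\cap((G\setminus\{g\})\times(M\setminus\{m\})))$. It is called rich if $|\mathfrak{B}(\mathbb{K}_{ -g-m})|\geq\frac12|\mathfrak{B}(\mathbb{K})|$. -}

module Defs where

open import Data.Bool using (Bool; true; false; _∧_; _∨_; not; if_then_else_)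
open import Data.Nat using (ℕ; zero; suc)
open import Data.Fin using (Fin; punchIn)
open import Data.Fin.Properties using () renaming (_≟_ to _≟ᶠ_)
open import Data.Vec using (Vec; []; _∷_; tabulate; lookup; foldr)
open import Data.Vec.Properties using (≡-dec)
open import Data.List using (List; []; _∷_; _++_; map; length; filter; cartesianProduct)
open import Data.Product using (_×_; _,_)
open import Data.Bool.Properties using () renaming (_≟_ to _≟ᵇ_)
open import Relation.Nullary.Decidable using (⌊_⌋; _×-dec_; Dec)
open import Relation.Binary.PropositionalEquality using (_≡_)

-- A finite formal context with object set G = Fin p and attribute set
-- M = Fin q; the incidence relation I is given by its characteristic
-- function (finite contexts have decidable incidence).
Context : ℕ → ℕ → Set
Context p q = Fin p → Fin q → Bool

Subset : ℕ → Set
Subset n = Vec Bool n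

allSubsets : (n : ℕ) → List (Subset n)
allSubsets zero = [] ∷ []
allSubsets (suc n) = map (true ∷_) (allSubsets n) ++ map (false ∷_) (allSubsets n)

allFinB : {n : ℕ} → (Fin n → Bool) → Bool
allFinB {n} P = foldr _ _∧_ true (tabulate P)

_↑_ : {p q : ℕ} → Context p q → Subset p → Subset q
_↑_ K A = tabulate λ m → allFinB λ g → not (lookup A g) ∨ K g m

_↓_ : {p q : ℕ} → Context p q → Subset q → Subset p
_↓_ K B = tabulate λ g → allFinB λ m → not (lookup B m) ∨ K g m

IsConcept : {p q : ℕ} → Context p q → Subset p × Subset q → Set
IsConcept K (A , B) = (K ↑ A ≡ B) × (K ↓ B ≡ A)

isConcept? : {p q : ℕ} (K : Context p q) (c : Subset p × Subset q) → Dec (IsConcept K c)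
isConcept? K (A , B) = ≡-dec _≟ᵇ_ (K ↑ A) B ×-dec ≡-dec _≟ᵇ_ (K ↓ B) A

numConcepts : {p q : ℕ} → Context p q → ℕ
numConcepts {p} {q} K = length (filter (isConcept? K) (cartesianProduct (allSubsets p) (allSubsets q)))

-- K_{-g-m}: delete object g and attribute m (remaining objects/attributes
-- are indexed via punchIn).
deleteGM : {p q : ℕ} → Context (suc p) (suc q) → Fin (suc p) → Fin (suc q) → Context p q
deleteGM K g m h n = K (punchIn g h) (punchIn m n)

extendJ : {p q : ℕ} → Context p q → Fin p → Fin q → Context p q
extendJ K g m h n =
  K h n ∨ (⌊ h ≟ᶠ g ⌋ ∧ not ⌊ n ≟ᶠ m ⌋) ∨ (not ⌊ h ≟ᶠ g ⌋ ∧ ⌊ n ≟ᶠ m ⌋)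

-- Adding to a context an object g and an attribute m that form a "cross"
-- (g has every attribute except m, and every object except g has m)
-- exactly doubles the number of concepts: a set A ∪ {g} or A is closed in
-- the enlarged context iff A is closed in the original one, because the
-- cross row and column only toggle g and m in the derivations.  Since J is
-- precisely such a cross extension of K₋g₋m (this uses (g,m) ∉ I), we get
-- |𝔅(J)| = 2|𝔅(K₋g₋m)|, and the two inequalities of the theorem coincide.
module Submission where

open import Defs
open import Algebra.Bundles using (CommutativeMonoid)
open import Data.Bool using (Bool; true; false; _∧_; _∨_; not)
open import Data.Bool.Properties
  using (∧-commutativeMonoid; ∧-identityʳ; ∨-identityʳ; ∨-zeroʳ; not-involutive)
  renaming (_≟_ to _≟ᵇ_)
open import Data.Fin using (Fin; zero; suc; punchIn)
open import Data.Fin.Properties using (punchInᵢ≢i) renaming (_≟_ to _≟ᶠ_)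
open import Data.List using (List; []; _∷_; _++_; map; length; filter; cartesianProduct)
open import Data.List.Properties using (length-++; filter-++; filter-≐; filter-accept; filter-reject; filter-none)
open import Data.List.Relation.Unary.All using (universal)
open import Data.Nat using (ℕ; zero; suc; _+_; _*_; _≤_)
open import Data.Nat.Properties using (+-commutativeSemigroup; +-identityʳ)
open import Data.Product using (_×_; _,_; proj₁)
open import Data.Vec using (Vec; []; _∷_; tabulate; lookup; foldr; insertAt; removeAt)
open import Data.Vec.Properties
  using (≡-dec; ∷-injectiveʳ; tabulate-cong; insertAt-lookup; insertAt-punchIn; removeAt-insertAt)
open import Function using (flip)
open import Function.Bundles using (_⇔_; mk⇔)
open import Level using (Level)
open import Relation.Binary.PropositionalEquality
  using (_≡_; refl; sym; trans; cong; cong₂; subst; module ≡-Reasoning)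
open import Relation.Nullary using (Dec; yes; no; does; ¬_)
open import Relation.Nullary.Decidable using (⌊_⌋; isYes≗does; dec-true; dec-false)
open import Relation.Unary using (Pred; Decidable; _≐_)

open import Algebra.Properties.CommutativeSemigroup +-commutativeSemigroup using (interchange)
open import Algebra.Properties.CommutativeSemigroup (CommutativeMonoid.commutativeSemigroup ∧-commutativeMonoid)
  using () renaming (x∙yz≈y∙xz to ∧-exchange)

open ≡-Reasoning

private
  variable
    a b ℓ ℓ′ : Level
    A : Set a
    B : Set b
    n p q : ℕ

count : {P : Pred A ℓ} → Decidable P → List A → ℕ
count P? xs = length (filter P? xs)

module _ {P : Pred A ℓ} (P? : Decidable P) where

  count-++ : (xs ys : List A) → count P? (xs ++ ys) ≡ count P? xs + count P? ys
  count-++ xs ys = trans (cong length (filter-++ P? xs ys)) (length-++ (filter P? xs))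

  count-map : (f : B → A) (xs : List B) → count P? (map f xs) ≡ count (λ x → P? (f x)) xs
  count-map f [] = refl
  count-map f (x ∷ xs) with does (P? (f x))
  ... | true  = cong suc (count-map f xs)
  ... | false = count-map f xs

  count-none : (∀ x → ¬ P x) → (xs : List A) → count P? xs ≡ 0
  count-none ¬P xs = cong length (filter-none P? (universal ¬P xs))

count-≐ : {P : Pred A ℓ} {Q : Pred A ℓ′} (P? : Decidable P) (Q? : Decidable Q) →
          P ≐ Q → (xs : List A) → count P? xs ≡ count Q? xs
count-≐ P? Q? P≐Q xs = cong length (filter-≐ P? Q? P≐Q xs)

count-cartesianProduct : {P : Pred (A × B) ℓ} {Q : Pred A ℓ′} (P? : Decidable P) (Q? : Decidable Q) →
  (xs : List A) (ys : List B) →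
  (∀ x → count (λ y → P? (x , y)) ys ≡ count Q? (x ∷ [])) →
  count P? (cartesianProduct xs ys) ≡ count Q? xs
count-cartesianProduct P? Q? [] ys fibre = refl
count-cartesianProduct P? Q? (x ∷ xs) ys fibre = begin
  count P? (map (x ,_) ys ++ cartesianProduct xs ys)
    ≡⟨ count-++ P? (map (x ,_) ys) (cartesianProduct xs ys) ⟩
  count P? (map (x ,_) ys) + count P? (cartesianProduct xs ys)
    ≡⟨ cong₂ _+_ (trans (count-map P? (x ,_) ys) (fibre x)) (count-cartesianProduct P? Q? xs ys fibre) ⟩
  count Q? (x ∷ []) + count Q? xs
    ≡⟨ count-++ Q? (x ∷ []) xs ⟨
  count Q? (x ∷ xs) ∎

infix 4 _≟ᵥ_
_≟ᵥ_ : (u v : Subset n) → Dec (u ≡ v)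
_≟ᵥ_ = ≡-dec _≟ᵇ_

count-allSubsets-suc : {P : Pred (Subset (suc n)) ℓ} (P? : Decidable P) →
  count P? (allSubsets (suc n)) ≡
  count (λ v → P? (true ∷ v)) (allSubsets n) + count (λ v → P? (false ∷ v)) (allSubsets n)
count-allSubsets-suc {n} P? =
  trans (count-++ P? (map (true ∷_) (allSubsets n)) (map (false ∷_) (allSubsets n)))
        (cong₂ _+_ (count-map P? (true ∷_) (allSubsets n)) (count-map P? (false ∷_) (allSubsets n)))

count-allSubsets-insertAt : (g : Fin (suc n)) {P : Pred (Subset (suc n)) ℓ} (P? : Decidable P) →
  count P? (allSubsets (suc n)) ≡
  count (λ v → P? (insertAt v g true)) (allSubsets n) + count (λ v → P? (insertAt v g false)) (allSubsets n)
count-allSubsets-insertAt zero P? = count-allSubsets-suc P?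
count-allSubsets-insertAt {suc n} (suc g) {P} P? = begin
  count P? (allSubsets (suc (suc n)))
    ≡⟨ count-allSubsets-suc P? ⟩
  count (λ v → P? (true ∷ v)) (allSubsets (suc n)) + count (λ v → P? (false ∷ v)) (allSubsets (suc n))
    ≡⟨ cong₂ _+_ (count-allSubsets-insertAt g (λ v → P? (true ∷ v)))
                 (count-allSubsets-insertAt g (λ v → P? (false ∷ v))) ⟩
  (count (at true true) S + count (at true false) S) + (count (at false true) S + count (at false false) S)
    ≡⟨ interchange (count (at true true) S) _ _ _ ⟩
  (count (at true true) S + count (at false true) S) + (count (at true false) S + count (at false false) S)
    ≡⟨ cong₂ _+_ (count-allSubsets-suc (λ v → P? (insertAt v (suc g) true)))
                 (count-allSubsets-suc (λ v → P? (insertAt v (suc g) false))) ⟨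
  count (λ v → P? (insertAt v (suc g) true)) (allSubsets (suc n)) +
  count (λ v → P? (insertAt v (suc g) false)) (allSubsets (suc n)) ∎
  where
  S : List (Subset n)
  S = allSubsets n
  at : (x y : Bool) → Decidable (λ v → P (x ∷ insertAt v g y))
  at x y v = P? (x ∷ insertAt v g y)

count-≟-allSubsets : (c : Subset n) → count (c ≟ᵥ_) (allSubsets n) ≡ 1
count-≟-allSubsets [] = refl
count-≟-allSubsets {suc n} (true ∷ c) = begin
  count ((true ∷ c) ≟ᵥ_) (allSubsets (suc n))
    ≡⟨ count-allSubsets-suc ((true ∷ c) ≟ᵥ_) ⟩
  count (λ v → (true ∷ c) ≟ᵥ (true ∷ v)) (allSubsets n) + count (λ v → (true ∷ c) ≟ᵥ (false ∷ v)) (allSubsets n)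
    ≡⟨ cong₂ _+_ (count-≐ _ (c ≟ᵥ_) (∷-injectiveʳ , cong (true ∷_)) (allSubsets n))
                 (count-none _ (λ _ ()) (allSubsets n)) ⟩
  count (c ≟ᵥ_) (allSubsets n) + 0
    ≡⟨ trans (+-identityʳ _) (count-≟-allSubsets c) ⟩
  1 ∎
count-≟-allSubsets {suc n} (false ∷ c) = begin
  count ((false ∷ c) ≟ᵥ_) (allSubsets (suc n))
    ≡⟨ count-allSubsets-suc ((false ∷ c) ≟ᵥ_) ⟩
  count (λ v → (false ∷ c) ≟ᵥ (true ∷ v)) (allSubsets n) + count (λ v → (false ∷ c) ≟ᵥ (false ∷ v)) (allSubsets n)
    ≡⟨ cong₂ _+_ (count-none _ (λ _ ()) (allSubsets n))
                 (count-≐ _ (c ≟ᵥ_) (∷-injectiveʳ , cong (false ∷_)) (allSubsets n)) ⟩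
  count (c ≟ᵥ_) (allSubsets n)
    ≡⟨ count-≟-allSubsets c ⟩
  1 ∎

IsExtent : Context p q → Subset p → Set
IsExtent K A = K ↓ (K ↑ A) ≡ A

isExtent? : (K : Context p q) → Decidable (IsExtent K)
isExtent? K A = K ↓ (K ↑ A) ≟ᵥ A

numConcepts≡numExtents : (K : Context p q) → numConcepts K ≡ count (isExtent? K) (allSubsets p)
numConcepts≡numExtents {p} {q} K =
  count-cartesianProduct (isConcept? K) (isExtent? K) (allSubsets p) (allSubsets q)
    (λ A → conceptsOver A (isExtent? K A))
  where
  conceptsOver : (A : Subset p) → Dec (IsExtent K A) →
    count (λ B → isConcept? K (A , B)) (allSubsets q) ≡ count (isExtent? K) (A ∷ [])
  conceptsOver A (yes closed) = begin
    count (λ B → isConcept? K (A , B)) (allSubsets q)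
      ≡⟨ count-≐ _ (K ↑ A ≟ᵥ_) (proj₁ , λ { refl → refl , closed }) (allSubsets q) ⟩
    count (K ↑ A ≟ᵥ_) (allSubsets q)
      ≡⟨ count-≟-allSubsets (K ↑ A) ⟩
    1
      ≡⟨ cong length (filter-accept (isExtent? K) closed) ⟨
    count (isExtent? K) (A ∷ []) ∎
  conceptsOver A (no open′) = begin
    count (λ B → isConcept? K (A , B)) (allSubsets q)
      ≡⟨ count-none _ (λ { B (refl , closed) → open′ closed }) (allSubsets q) ⟩
    0
      ≡⟨ cong length (filter-reject (isExtent? K) open′) ⟨
    count (isExtent? K) (A ∷ []) ∎

allFinB-cong : {P Q : Fin n → Bool} → (∀ i → P i ≡ Q i) → allFinB P ≡ allFinB Q
allFinB-cong P≗Q = cong (foldr _ _∧_ true) (tabulate-cong P≗Q)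

allFinB-true : allFinB {n} (λ _ → true) ≡ true
allFinB-true {zero}  = refl
allFinB-true {suc n} = allFinB-true {n}

allFinB-punchIn : (i : Fin (suc n)) (P : Fin (suc n) → Bool) → allFinB P ≡ P i ∧ allFinB (λ j → P (punchIn i j))
allFinB-punchIn zero P = refl
allFinB-punchIn {suc n} (suc i) P =
  trans (cong (P zero ∧_) (allFinB-punchIn i (λ j → P (suc j)))) (∧-exchange (P zero) (P (suc i)) _)

tabulate-punchIn : (i : Fin (suc n)) (f : Fin (suc n) → A) → tabulate f ≡ insertAt (tabulate (λ j → f (punchIn i j))) i (f i)
tabulate-punchIn zero f = refl
tabulate-punchIn {n = suc n} (suc i) f = cong (f zero ∷_) (tabulate-punchIn i (λ j → f (suc j)))

insertAt-injective : (i : Fin (suc n)) (x : A) {u v : Vec A n} → insertAt u i x ≡ insertAt v i x → u ≡ v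
insertAt-injective i x {u} {v} eq =
  trans (sym (removeAt-insertAt u i x)) (trans (cong (λ w → removeAt w i) eq) (removeAt-insertAt v i x))

↑-insertAt : (L : Context (suc p) q) (g : Fin (suc p)) (A : Subset p) (b : Bool) →
  L ↑ insertAt A g b ≡ tabulate (λ n → (not b ∨ L g n) ∧ allFinB (λ i → not (lookup A i) ∨ L (punchIn g i) n))
↑-insertAt L g A b = tabulate-cong λ n → begin
  allFinB (λ h → not (lookup (insertAt A g b) h) ∨ L h n)
    ≡⟨ allFinB-punchIn g (λ h → not (lookup (insertAt A g b) h) ∨ L h n) ⟩
  (not (lookup (insertAt A g b) g) ∨ L g n) ∧ allFinB (λ i → not (lookup (insertAt A g b) (punchIn g i)) ∨ L (punchIn g i) n)
    ≡⟨ cong₂ _∧_ (cong (λ x → not x ∨ L g n) (insertAt-lookup A g b))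
                 (allFinB-cong λ i → cong (λ x → not x ∨ L (punchIn g i) n) (insertAt-punchIn A g b i)) ⟩
  (not b ∨ L g n) ∧ allFinB (λ i → not (lookup A i) ∨ L (punchIn g i) n) ∎

record IsCrossExtension (K : Context p q) (L : Context (suc p) (suc q)) (g : Fin (suc p)) (m : Fin (suc q)) : Set where
  field
    corner : L g m ≡ false
    row    : ∀ j → L g (punchIn m j) ≡ true
    column : ∀ i → L (punchIn g i) m ≡ true
    inner  : ∀ i j → L (punchIn g i) (punchIn m j) ≡ K i j

isCrossExtension-flip : {K : Context p q} {L : Context (suc p) (suc q)} {g : Fin (suc p)} {m : Fin (suc q)} →
  IsCrossExtension K L g m → IsCrossExtension (flip K) (flip L) m g
isCrossExtension-flip cross = record { corner = corner ; row = column ; column = row ; inner = flip inner }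
  where open IsCrossExtension cross

↑-crossExtension : {K : Context p q} {L : Context (suc p) (suc q)} {g : Fin (suc p)} {m : Fin (suc q)} →
  IsCrossExtension K L g m → (A : Subset p) (b : Bool) → L ↑ insertAt A g b ≡ insertAt (K ↑ A) m (not b)
↑-crossExtension {p} {q} {K} {L} {g} {m} cross A b = begin
  L ↑ insertAt A g b                                    ≡⟨ ↑-insertAt L g A b ⟩
  tabulate F                                            ≡⟨ tabulate-punchIn m F ⟩
  insertAt (tabulate (λ j → F (punchIn m j))) m (F m)   ≡⟨ cong₂ (λ v x → insertAt v m x) (tabulate-cong F-punchIn) F-m ⟩
  insertAt (K ↑ A) m (not b)                            ∎
  where
  open IsCrossExtension cross
  F : Fin (suc q) → Bool
  F n = (not b ∨ L g n) ∧ allFinB (λ i → not (lookup A i) ∨ L (punchIn g i) n)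
  F-m : F m ≡ not b
  F-m = begin
    (not b ∨ L g m) ∧ allFinB (λ i → not (lookup A i) ∨ L (punchIn g i) m)
      ≡⟨ cong₂ _∧_ (cong (not b ∨_) corner)
                   (allFinB-cong λ i → trans (cong (not (lookup A i) ∨_) (column i)) (∨-zeroʳ _)) ⟩
    (not b ∨ false) ∧ allFinB {p} (λ _ → true)
      ≡⟨ cong₂ _∧_ (∨-identityʳ (not b)) (allFinB-true {p}) ⟩
    not b ∧ true
      ≡⟨ ∧-identityʳ (not b) ⟩
    not b ∎
  F-punchIn : ∀ j → F (punchIn m j) ≡ allFinB (λ i → not (lookup A i) ∨ K i j)
  F-punchIn j = cong₂ _∧_ (trans (cong (not b ∨_) (row j)) (∨-zeroʳ _))
                          (allFinB-cong λ i → cong (not (lookup A i) ∨_) (inner i j))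

module _ {K : Context p q} {L : Context (suc p) (suc q)} {g : Fin (suc p)} {m : Fin (suc q)} where

  -- K ↓ B is definitionally flip K ↑ B.
  ↓-crossExtension : IsCrossExtension K L g m → (B : Subset q) (c : Bool) →
    L ↓ insertAt B m c ≡ insertAt (K ↓ B) g (not c)
  ↓-crossExtension cross = ↑-crossExtension (isCrossExtension-flip cross)

  ↓↑-crossExtension : IsCrossExtension K L g m → (A : Subset p) (b : Bool) →
    L ↓ (L ↑ insertAt A g b) ≡ insertAt (K ↓ (K ↑ A)) g b
  ↓↑-crossExtension cross A b = begin
    L ↓ (L ↑ insertAt A g b)                   ≡⟨ cong (L ↓_) (↑-crossExtension cross A b) ⟩
    L ↓ insertAt (K ↑ A) m (not b)             ≡⟨ ↓-crossExtension cross (K ↑ A) (not b) ⟩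
    insertAt (K ↓ (K ↑ A)) g (not (not b))     ≡⟨ cong (insertAt (K ↓ (K ↑ A)) g) (not-involutive b) ⟩
    insertAt (K ↓ (K ↑ A)) g b                 ∎

  isExtent-crossExtension : IsCrossExtension K L g m → (b : Bool) →
    (λ A → IsExtent L (insertAt A g b)) ≐ IsExtent K
  isExtent-crossExtension cross b =
    (λ {A} closed → insertAt-injective g b (trans (sym (↓↑-crossExtension cross A b)) closed)) ,
    (λ {A} closed → trans (↓↑-crossExtension cross A b) (cong (λ v → insertAt v g b) closed))

  numConcepts-crossExtension : IsCrossExtension K L g m → numConcepts L ≡ 2 * numConcepts K
  numConcepts-crossExtension cross = begin
    numConcepts L
      ≡⟨ numConcepts≡numExtents L ⟩
    count (isExtent? L) (allSubsets (suc p))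
      ≡⟨ count-allSubsets-insertAt g (isExtent? L) ⟩
    count (λ A → isExtent? L (insertAt A g true)) (allSubsets p) + count (λ A → isExtent? L (insertAt A g false)) (allSubsets p)
      ≡⟨ cong₂ _+_ (count-≐ _ (isExtent? K) (isExtent-crossExtension cross true) (allSubsets p))
                   (count-≐ _ (isExtent? K) (isExtent-crossExtension cross false) (allSubsets p)) ⟩
    count (isExtent? K) (allSubsets p) + count (isExtent? K) (allSubsets p)
      ≡⟨ cong₂ _+_ (numConcepts≡numExtents K) (numConcepts≡numExtents K) ⟨
    numConcepts K + numConcepts K
      ≡⟨ cong (numConcepts K +_) (+-identityʳ (numConcepts K)) ⟨
    2 * numConcepts K ∎

⌊i≟i⌋ : (i : Fin n) → ⌊ i ≟ᶠ i ⌋ ≡ true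
⌊i≟i⌋ i = trans (isYes≗does (i ≟ᶠ i)) (dec-true (i ≟ᶠ i) refl)

⌊punchIn≟i⌋ : (i : Fin (suc n)) (j : Fin n) → ⌊ punchIn i j ≟ᶠ i ⌋ ≡ false
⌊punchIn≟i⌋ i j = trans (isYes≗does (punchIn i j ≟ᶠ i)) (dec-false (punchIn i j ≟ᶠ i) (punchInᵢ≢i i j))

extendJ-isCrossExtension : (K : Context (suc p) (suc q)) (g : Fin (suc p)) (m : Fin (suc q)) →
  K g m ≡ false → IsCrossExtension (deleteGM K g m) (extendJ K g m) g m
extendJ-isCrossExtension K g m Kgm≡false = record
  { corner = corner ; row = row ; column = column ; inner = inner }
  where
  corner : extendJ K g m g m ≡ false
  corner rewrite Kgm≡false | ⌊i≟i⌋ g | ⌊i≟i⌋ m = refl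
  row : ∀ j → extendJ K g m g (punchIn m j) ≡ true
  row j rewrite ⌊i≟i⌋ g | ⌊punchIn≟i⌋ m j = ∨-zeroʳ _
  column : ∀ i → extendJ K g m (punchIn g i) m ≡ true
  column i rewrite ⌊punchIn≟i⌋ g i | ⌊i≟i⌋ m = ∨-zeroʳ _
  inner : ∀ i j → extendJ K g m (punchIn g i) (punchIn m j) ≡ deleteGM K g m i j
  inner i j rewrite ⌊punchIn≟i⌋ g i | ⌊punchIn≟i⌋ m j = ∨-identityʳ _

proposition1 : {p q : ℕ} (K : Context (suc p) (suc q)) (g : Fin (suc p)) (m : Fin (suc q)) →
    K g m ≡ false →
    (numConcepts K ≤ 2 * numConcepts (deleteGM K g m)) ⇔ (numConcepts K ≤ numConcepts (extendJ K g m))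
proposition1 K g m Kgm≡false =
  mk⇔ (subst (numConcepts K ≤_) (sym doubling)) (subst (numConcepts K ≤_) doubling)
  where
  doubling : numConcepts (extendJ K g m) ≡ 2 * numConcepts (deleteGM K g m)
  doubling = numConcepts-crossExtension (extendJ-isCrossExtension K g m Kgm≡false)
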